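{- Let $\Gamma,\Delta$ be finite sets of formulas in $For_2$ with $\Gamma\cup\Delta$ nonempty. If $\Gamma\Rightarrow\Delta$ is provable in the $\{\lnot,\wedge\}$-fragment of the classical calculus $\mathbf{C}$ and $var(\Delta)\subseteq var(\Gamma)$, then $\Gamma\Rightarrow\Delta$ is provable in $\mathbf{B}$ without using the Cut rule.
   Context: Fix a denumerable set $prop$ of propositional variables. $For_2$ is the set of formulas built from $prop$ with unary $\lnot$ and binary $\wedge$. $var(\alpha)$ is the set of propositional variables in $\alpha$; $var(\Gamma)=\bigcup_{\gamma\in\Gamma}var(\gamma)$. A sequent $\Gamma\Rightarrow\Delta$ is an ordered pair of finite sets of formulas, not both empty; $\alpha,\Gamma$ denotes $\Gamma\cup\{\alpha\}$. The $\{\lnot,\wedge\}$-fragment of $\mathbf{C}$ has the axiom $\alpha\Rightarrow\alpha$ and the rules (premises / conclusion): (W$\Rightarrow$) $\Gamma\Rightarrow\Delta$ / $\alpha,\Gamma\Rightarrow\Delta$; ($\Rightarrow$W) $\Gamma\Rightarrow\Delta$ / $\Gamma\Rightarrow\Delta,\alpha$; (Cut) $\Gamma\Rightarrow\Delta,\alpha$ and $\alpha,\Gamma\Rightarrow\Delta$ / $\Gamma\Rightarrow\Delta$; ($\lnot\Rightarrow$) $\Gamma\Rightarrow\Delta,\alpha$ / $\lnot\alpha,\Gamma\Rightarrow\Delta$; ($\Rightarrow\lnot$) $\alpha,\Gamma\Rightarrow\Delta$ / $\Gamma\Rightarrow\Delta,\lnot\alpha$; ($\wedge\Rightarrow$)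 $\alpha_1,\alpha_2,\Gamma\Rightarrow\Delta$ / $\alpha_1\wedge\alpha_2,\Gamma\Rightarrow\Delta$; ($\Rightarrow\wedge$) $\Gamma\Rightarrow\Delta,\alpha_1$ and $\Gamma\Rightarrow\Delta,\alpha_2$ / $\Gamma\Rightarrow\Delta,\alpha_1\wedge\alpha_2$. The calculus $\mathbf{B}$ is identical except that ($\Rightarrow\lnot$) is replaced by ($\Rightarrow\lnot^B$): $\alpha,\Gamma\Rightarrow\Delta$ / $\Gamma\Rightarrow\Delta,\lnot\alpha$, allowed only if $var(\alpha)\subseteq var(\Gamma)$. -}

module Defs where

open import Data.Nat using (ℕ)
open import Data.Bool using (Bool; true; false)
open import Data.List using (List; []; _∷_; [_]; _++_)
open import Data.List.Membership.Propositional using (_∈_)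
open import Data.Product using (_×_)
open import Relation.Binary.PropositionalEquality using (_≡_)
open import Relation.Nullary using (¬_)

Prop : Set
Prop = ℕ

data For : Set where
  var  : Prop → For
  ¬'_  : For → For
  _∧'_ : For → For → For

vars : For → List Prop
vars (var p)   = p ∷ []
vars (¬' α)    = vars α
vars (α ∧' β)  = vars α ++ vars β

varsL : List For → List Prop
varsL []      = []
varsL (γ ∷ Γ) = vars γ ++ varsL Γ

-- Finite sets of formulas are represented by lists, up to set equality _≋_.
_≋_ : List For → List For → Set
A ≋ B = ∀ x → (x ∈ A → x ∈ B) × (x ∈ B → x ∈ A)

_⊆ᵥ_ : For → List For → Set
α ⊆ᵥ Γ = ∀ p → p ∈ vars α → p ∈ varsL Γ

_⊆ᵥᴸ_ : List For → List For → Set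
Δ ⊆ᵥᴸ Γ = ∀ p → p ∈ varsL Δ → p ∈ varsL Γ

NonEmptySeq : List For → List For → Set
NonEmptySeq Γ Δ = ¬ (Γ ≡ [] × Δ ≡ [])

-- Derivability in the {¬,∧}-fragment.
--   b = true  : calculus B (the (⇒¬) rule carries the restriction var(α) ⊆ var(Γ));
--   b = false : calculus C.
--   c = true  : Cut allowed;  c = false : Cut not allowed.
-- Each rule's conclusion is allowed to be any pair of lists set-equal to the
-- displayed one, so that derivability concerns sequents of finite *sets*
-- (α,Γ means Γ ∪ {α}).
data Deriv (b c : Bool) : List For → List For → Set where
  ax   : ∀ {Γ Δ} α → Γ ≋ [ α ] → Δ ≋ [ α ] → Deriv b c Γ Δ
  wL   : ∀ {Γ Δ Γ' Δ'} α → Deriv b c Γ Δ →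
         Γ' ≋ (α ∷ Γ) → Δ' ≋ Δ → Deriv b c Γ' Δ'
  wR   : ∀ {Γ Δ Γ' Δ'} α → Deriv b c Γ Δ →
         Γ' ≋ Γ → Δ' ≋ (α ∷ Δ) → Deriv b c Γ' Δ'
  cut  : ∀ {Γ Δ Γ' Δ'} α → c ≡ true →
         Deriv b c Γ (α ∷ Δ) → Deriv b c (α ∷ Γ) Δ →
         NonEmptySeq Γ Δ →
         Γ' ≋ Γ → Δ' ≋ Δ → Deriv b c Γ' Δ'
  negL : ∀ {Γ Δ Γ' Δ'} α → Deriv b c Γ (α ∷ Δ) →
         Γ' ≋ ((¬' α) ∷ Γ) → Δ' ≋ Δ → Deriv b c Γ' Δ'
  negR : ∀ {Γ Δ Γ' Δ'} α → Deriv b c (α ∷ Γ) Δ →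
         (b ≡ true → α ⊆ᵥ Γ) →
         Γ' ≋ Γ → Δ' ≋ ((¬' α) ∷ Δ) → Deriv b c Γ' Δ'
  andL : ∀ {Γ Δ Γ' Δ'} α₁ α₂ → Deriv b c (α₁ ∷ α₂ ∷ Γ) Δ →
         Γ' ≋ ((α₁ ∧' α₂) ∷ Γ) → Δ' ≋ Δ → Deriv b c Γ' Δ'
  andR : ∀ {Γ Δ Γ' Δ'} α₁ α₂ → Deriv b c Γ (α₁ ∷ Δ) → Deriv b c Γ (α₂ ∷ Δ) →
         Γ' ≋ Γ → Δ' ≋ ((α₁ ∧' α₂) ∷ Δ) → Deriv b c Γ' Δ'

ProvC : List For → List For → Set
ProvC = Deriv false true

ProvBcutfree : List For → List For → Set
ProvBcutfree = Deriv true false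

module Submission where

-- The proof is a semantic detour through two-valued valuations.
-- (1) Soundness: every derivation, in either calculus and with or without
--     Cut, only proves valid sequents (no valuation makes Γ true and Δ false).
-- (2) Completeness of cut-free B: a valid sequent with var(Δ) ⊆ var(Γ) is
--     derived by backward proof search with the invertible logical rules.
--     Since sequents are sets, principal formulas are never removed; the
--     search is instead driven by an agenda of signed formulas still to be
--     decomposed, together with the atoms met so far.  Invariant: the
--     variables of every succedent formula on the agenda occur in the current
--     antecedent.  Subformulas have fewer variables and antecedents only
--     grow, so the invariant persists, and it is exactly the side condition
--     of (⇒¬ᴮ).  On an empty agenda, the valuation true exactly on the
--     antecedent atoms is not a countermodel, so some atom lies on both sides
--     and the sequent is an axiom up to weakening.

open import Defs
open import Data.Bool using (Bool; T)
open import Data.Empty using (⊥; ⊥-elim)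
open import Data.List using (List; []; _∷_; [_]; _++_; map)
open import Data.List.Membership.Propositional using (_∈_; find; lose)
open import Data.List.Membership.Propositional.Properties using (∈-++⁺ˡ; ∈-++⁺ʳ; ∈-++⁻)
open import Data.Nat using (ℕ; zero; suc; _+_; _<_; s≤s; _≟_)
open import Data.List.Membership.DecPropositional _≟_ using (_∈?_)
open import Data.List.Relation.Unary.All using (All; []; _∷_; lookup; tabulate)
import Data.List.Relation.Unary.All as All
import Data.List.Relation.Unary.All.Properties as Allₚ
open import Data.List.Relation.Unary.Any using (here; there; any?)
open import Data.Nat.Properties using (+-assoc; +-monoˡ-≤; m≤m+n; m≤n+m; ≤-trans; n<1+n)
open import Data.Product using (_×_; _,_; proj₁; proj₂; ∃)
open import Data.Sum using (_⊎_; inj₁; inj₂)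
open import Relation.Nullary using (¬_; yes; no)
open import Relation.Nullary.Decidable using (⌊_⌋; toWitness; fromWitness)
open import Relation.Binary.PropositionalEquality using (refl; subst)

variable
  b c : Bool
  α : For
  Γ Γ' Δ Δ' : List For

≋-refl : ∀ {A} → A ≋ A
≋-refl x = (λ m → m) , (λ m → m)

≋-trans : ∀ {A B C} → A ≋ B → B ≋ C → A ≋ C
≋-trans p q x = (λ m → proj₁ (q x) (proj₁ (p x) m)) , (λ m → proj₂ (p x) (proj₂ (q x) m))

absorb : ∀ {a A} → a ∈ A → A ≋ (a ∷ A)
absorb a∈A x = there , λ { (here refl) → a∈A ; (there m) → m }

absorb-end : ∀ {a} A → a ∈ A → A ≋ (A ++ [ a ])
absorb-end {a} A a∈A x = ∈-++⁺ˡ , λ m → from (∈-++⁻ A m)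
  where
    from : x ∈ A ⊎ x ∈ [ a ] → x ∈ A
    from (inj₁ m)          = m
    from (inj₂ (here refl)) = a∈A

resp : Deriv b c Γ Δ → Γ' ≋ Γ → Δ' ≋ Δ → Deriv b c Γ' Δ'
resp (ax α p q)              e f = ax α (≋-trans e p) (≋-trans f q)
resp (wL α d p q)            e f = wL α d (≋-trans e p) (≋-trans f q)
resp (wR α d p q)            e f = wR α d (≋-trans e p) (≋-trans f q)
resp (cut α on d₁ d₂ ne p q) e f = cut α on d₁ d₂ ne (≋-trans e p) (≋-trans f q)
resp (negL α d p q)          e f = negL α d (≋-trans e p) (≋-trans f q)
resp (negR α d r p q)        e f = negR α d r (≋-trans e p) (≋-trans f q)
resp (andL α β d p q)        e f = andL α β d (≋-trans e p) (≋-trans f q)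
resp (andR α β d₁ d₂ p q)    e f = andR α β d₁ d₂ (≋-trans e p) (≋-trans f q)

weakenˡ : ∀ X → Deriv b c Γ Δ → Deriv b c (X ++ Γ) Δ
weakenˡ []      d = d
weakenˡ (x ∷ X) d = wL x (weakenˡ X d) ≋-refl ≋-refl

weakenʳ : ∀ X → Deriv b c Γ Δ → Deriv b c Γ (X ++ Δ)
weakenʳ []      d = d
weakenʳ (x ∷ X) d = wR x (weakenʳ X d) ≋-refl ≋-refl

axiom-∈ : α ∈ Γ → α ∈ Δ → Deriv b c Γ Δ
axiom-∈ {α} {Γ} {Δ} α∈Γ α∈Δ =
  resp (weakenʳ Δ (weakenˡ Γ (ax α ≋-refl ≋-refl))) (absorb-end Γ α∈Γ) (absorb-end Δ α∈Δ)

-- Truth is a proposition, and validity of a sequent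
-- is the absence of a countermodel; in this negative form all soundness
-- arguments, including the one for Cut, are constructive.

Valuation : Set
Valuation = Prop → Bool

infix 4 _⊨_
_⊨_ : Valuation → For → Set
v ⊨ var p  = T (v p)
v ⊨ ¬' α   = ¬ (v ⊨ α)
v ⊨ α ∧' β = v ⊨ α × v ⊨ β

Valid : List For → List For → Set
Valid Γ Δ = ∀ v → All (v ⊨_) Γ → All (λ δ → ¬ (v ⊨ δ)) Δ → ⊥

all-resp : ∀ {P : For → Set} {A A'} → A' ≋ A → All P A' → All P A
all-resp e as = tabulate (λ {x} x∈A → lookup as (proj₂ (e x) x∈A))

valid-resp : Γ' ≋ Γ → Δ' ≋ Δ → Valid Γ Δ → Valid Γ' Δ'
valid-resp e f d v as bs = d v (all-resp e as) (all-resp f bs)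

valid-ax : Valid [ α ] [ α ]
valid-ax v (a ∷ []) (na ∷ []) = na a

valid-wL : Valid Γ Δ → Valid (α ∷ Γ) Δ
valid-wL d v (_ ∷ as) bs = d v as bs

valid-wR : Valid Γ Δ → Valid Γ (α ∷ Δ)
valid-wR d v as (_ ∷ bs) = d v as bs

valid-cut : Valid Γ (α ∷ Δ) → Valid (α ∷ Γ) Δ → Valid Γ Δ
valid-cut d₁ d₂ v as bs = d₁ v as ((λ a → d₂ v (a ∷ as) bs) ∷ bs)

valid-negL : Valid Γ (α ∷ Δ) → Valid (¬' α ∷ Γ) Δ
valid-negL d v (na ∷ as) bs = d v as (na ∷ bs)

valid-negR : Valid (α ∷ Γ) Δ → Valid Γ (¬' α ∷ Δ)
valid-negR d v as (nna ∷ bs) = nna (λ a → d v (a ∷ as) bs)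

valid-andL : ∀ {β} → Valid (α ∷ β ∷ Γ) Δ → Valid (α ∧' β ∷ Γ) Δ
valid-andL d v ((a , b) ∷ as) bs = d v (a ∷ b ∷ as) bs

valid-andR : ∀ {β} → Valid Γ (α ∷ Δ) → Valid Γ (β ∷ Δ) → Valid Γ (α ∧' β ∷ Δ)
valid-andR d₁ d₂ v as (nab ∷ bs) =
  d₁ v as ((λ a → d₂ v as ((λ b → nab (a , b)) ∷ bs)) ∷ bs)

sound : Deriv b c Γ Δ → Valid Γ Δ
sound (ax α p q)             = valid-resp p q valid-ax
sound (wL α d p q)           = valid-resp p q (valid-wL (sound d))
sound (wR α d p q)           = valid-resp p q (valid-wR (sound d))
sound (cut α _ d₁ d₂ _ p q)  = valid-resp p q (valid-cut (sound d₁) (sound d₂))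
sound (negL α d p q)         = valid-resp p q (valid-negL (sound d))
sound (negR α d _ p q)       = valid-resp p q (valid-negR (sound d))
sound (andL α β d p q)       = valid-resp p q (valid-andL (sound d))
sound (andR α β d₁ d₂ p q)   = valid-resp p q (valid-andR (sound d₁) (sound d₂))

varsL-∈ : ∀ {x Γ p} → x ∈ Γ → p ∈ vars x → p ∈ varsL Γ
varsL-∈ (here refl)          m = ∈-++⁺ˡ m
varsL-∈ {Γ = y ∷ _} (there k) m = ∈-++⁺ʳ (vars y) (varsL-∈ k m)

-- Agendas for proof search: signed formulas still to be decomposed, on the
-- antecedent side (L) or on the succedent side (R).

data Signed : Set where
  L R : For → Signed

-- Symbol count of a formula, summed over an agenda; every decomposition
-- step lowers the weight, which bounds the proof search.
size : For → ℕ
size (var p)  = 1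
size (¬' α)   = suc (size α)
size (α ∧' β) = suc (size α + size β)

weight : List Signed → ℕ
weight []         = 0
weight (L α ∷ ts) = size α + weight ts
weight (R α ∷ ts) = size α + weight ts

-- Where a signed formula must already sit in the sequent Γ ⇒ Δ under
-- construction; succedent formulas carry the variable condition of B.
Placed : List For → List For → Signed → Set
Placed Γ Δ (L α) = α ∈ Γ
Placed Γ Δ (R α) = α ∈ Δ × α ⊆ᵥ Γ

placed-growΓ : ∀ {ts} α → All (Placed Γ Δ) ts → All (Placed (α ∷ Γ) Δ) ts
placed-growΓ {ts = []}      α []                = []
placed-growΓ {ts = L _ ∷ _} α (m ∷ pl)          = there m ∷ placed-growΓ α pl
placed-growΓ {ts = R _ ∷ _} α ((m , s) ∷ pl)    =
  (m , λ p k → ∈-++⁺ʳ (vars α) (s p k)) ∷ placed-growΓ α pl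

placed-growΔ : ∀ {ts} α → All (Placed Γ Δ) ts → All (Placed Γ (α ∷ Δ)) ts
placed-growΔ {ts = []}      α []             = []
placed-growΔ {ts = L _ ∷ _} α (m ∷ pl)       = m ∷ placed-growΔ α pl
placed-growΔ {ts = R _ ∷ _} α ((m , s) ∷ pl) = (there m , s) ∷ placed-growΔ α pl

Agrees : Valuation → Signed → Set
Agrees v (L α) = v ⊨ α
Agrees v (R α) = ¬ (v ⊨ α)

Entails : List Signed → List Prop → List Prop → Set
Entails ts ps qs = ∀ v → All (Agrees v) ts → All (λ p → T (v p)) ps → All (λ q → ¬ T (v q)) qs → ⊥

-- Decomposing the first agenda entry preserves entailment; these are the
-- semantic counterparts of the invertibility of the logical rules.

entails-Lvar : ∀ {p ts ps qs} → Entails (L (var p) ∷ ts) ps qs → Entails ts (p ∷ ps) qs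
entails-Lvar e v as (a ∷ ps) qs = e v (a ∷ as) ps qs

entails-Rvar : ∀ {q ts ps qs} → Entails (R (var q) ∷ ts) ps qs → Entails ts ps (q ∷ qs)
entails-Rvar e v as ps (na ∷ qs) = e v (na ∷ as) ps qs

entails-Lneg : ∀ {ts ps qs} → Entails (L (¬' α) ∷ ts) ps qs → Entails (R α ∷ ts) ps qs
entails-Lneg e v (na ∷ as) = e v (na ∷ as)

entails-Rneg : ∀ {ts ps qs} → Entails (R (¬' α) ∷ ts) ps qs → Entails (L α ∷ ts) ps qs
entails-Rneg e v (a ∷ as) = e v ((λ na → na a) ∷ as)

entails-Land : ∀ {β ts ps qs} → Entails (L (α ∧' β) ∷ ts) ps qs → Entails (L α ∷ L β ∷ ts) ps qs
entails-Land e v (a ∷ b ∷ as) = e v ((a , b) ∷ as)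

entails-Rand : ∀ {β ts ps qs} → Entails (R (α ∧' β) ∷ ts) ps qs →
               Entails (R α ∷ ts) ps qs × Entails (R β ∷ ts) ps qs
entails-Rand e = (λ v → λ { (na ∷ as) → e v ((λ ab → na (proj₁ ab)) ∷ as) })
               , (λ v → λ { (nb ∷ as) → e v ((λ ab → nb (proj₂ ab)) ∷ as) })

-- With nothing left to decompose, the valuation true exactly on ps is not a
-- countermodel, which forces an atom common to ps and qs.
shared-atom : ∀ ps qs → Entails [] ps qs → ∃ λ p → p ∈ ps × p ∈ qs
shared-atom ps qs e with any? (_∈? ps) qs
... | yes common = let (p , p∈qs , p∈ps) = find common in p , p∈ps , p∈qs
... | no disjoint = ⊥-elim (e (λ p → ⌊ p ∈? ps ⌋) []
                              (tabulate fromWitness)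
                              (tabulate (λ q∈qs t → disjoint (lose q∈qs (toWitness t)))))

lighter-∧ˡ : ∀ α β k → size α + k < size (α ∧' β) + k
lighter-∧ˡ α β k = s≤s (+-monoˡ-≤ k (m≤m+n (size α) (size β)))

lighter-∧ʳ : ∀ α β k → size β + k < size (α ∧' β) + k
lighter-∧ʳ α β k = s≤s (+-monoˡ-≤ k (m≤n+m (size β) (size α)))

search : ∀ n ts ps qs → weight ts < n → All (Placed Γ Δ) ts →
         All (λ p → var p ∈ Γ) ps → All (λ q → var q ∈ Δ) qs →
         Entails ts ps qs → ProvBcutfree Γ Δ
search zero _ _ _ () _ _ _ _
search (suc n) [] ps qs _ _ inΓ inΔ e with shared-atom ps qs e
... | p , p∈ps , p∈qs = axiom-∈ (lookup inΓ p∈ps) (lookup inΔ p∈qs)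
search (suc n) (L (var p) ∷ ts) ps qs (s≤s w) (m ∷ pl) inΓ inΔ e =
  search n ts (p ∷ ps) qs w pl (m ∷ inΓ) inΔ (entails-Lvar e)
search (suc n) (R (var q) ∷ ts) ps qs (s≤s w) ((m , _) ∷ pl) inΓ inΔ e =
  search n ts ps (q ∷ qs) w pl inΓ (m ∷ inΔ) (entails-Rvar e)
search (suc n) (L (¬' α) ∷ ts) ps qs (s≤s w) (m ∷ pl) inΓ inΔ e =
  negL α (search n (R α ∷ ts) ps qs w ((here refl , λ p k → varsL-∈ m k) ∷ placed-growΔ α pl)
                 inΓ (All.map there inΔ) (entails-Lneg e))
       (absorb m) ≋-refl
search (suc n) (R (¬' α) ∷ ts) ps qs (s≤s w) ((m , s) ∷ pl) inΓ inΔ e =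
  negR α (search n (L α ∷ ts) ps qs w (here refl ∷ placed-growΓ α pl)
                 (All.map there inΓ) inΔ (entails-Rneg e))
       (λ _ → s) ≋-refl (absorb m)
search (suc n) (L (α ∧' β) ∷ ts) ps qs (s≤s w) (m ∷ pl) inΓ inΔ e =
  andL α β (search n (L α ∷ L β ∷ ts) ps qs lighter
                   (here refl ∷ there (here refl) ∷ placed-growΓ α (placed-growΓ β pl))
                   (All.map (λ k → there (there k)) inΓ) inΔ (entails-Land e))
       (absorb m) ≋-refl
  where
    lighter : size α + (size β + weight ts) < n
    lighter = subst (_< n) (+-assoc (size α) (size β) (weight ts)) w
search {Γ} {Δ} (suc n) (R (α ∧' β) ∷ ts) ps qs (s≤s w) ((m , s) ∷ pl) inΓ inΔ e =
  andR α β (premise α (lighter-∧ˡ α β _) (λ p k → s p (∈-++⁺ˡ k)) (proj₁ (entails-Rand e)))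
           (premise β (lighter-∧ʳ α β _) (λ p k → s p (∈-++⁺ʳ (vars α) k)) (proj₂ (entails-Rand e)))
       ≋-refl (absorb m)
  where
    premise : ∀ γ → size γ + weight ts < size (α ∧' β) + weight ts → γ ⊆ᵥ Γ →
              Entails (R γ ∷ ts) ps qs → ProvBcutfree Γ (γ ∷ Δ)
    premise γ lighter γ⊆Γ eγ =
      search n (R γ ∷ ts) ps qs (≤-trans lighter w) ((here refl , γ⊆Γ) ∷ placed-growΔ γ pl)
             inΓ (All.map there inΔ) eγ

complete : Valid Γ Δ → Δ ⊆ᵥᴸ Γ → ProvBcutfree Γ Δ
complete {Γ} {Δ} valid sub =
  search _ agenda [] [] (n<1+n _) placed [] [] entailed
  where
    agenda : List Signed
    agenda = map L Γ ++ map R Δ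
    placed : All (Placed Γ Δ) agenda
    placed = Allₚ.++⁺ (Allₚ.map⁺ (tabulate (λ γ∈Γ → γ∈Γ)))
                     (Allₚ.map⁺ (tabulate (λ δ∈Δ → δ∈Δ , λ p k → sub p (varsL-∈ δ∈Δ k))))
    entailed : Entails agenda [] []
    entailed v agree _ _ = valid v (Allₚ.map⁻ (Allₚ.++⁻ˡ (map L Γ) agree))
                                   (Allₚ.map⁻ (Allₚ.++⁻ʳ (map L Γ) agree))

mainTheorem18 : (Γ Δ : List For) → NonEmptySeq Γ Δ → ProvC Γ Δ → Δ ⊆ᵥᴸ Γ → ProvBcutfree Γ Δ
mainTheorem18 Γ Δ _ d sub = complete (sound d) sub
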